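{- Let $H_1$ and $H_2$ be hypergraphs. Then $\tau(H_1\rtimes H_2)=\tau(H_1)\,\tau(H_2)$.
   Context: The cover number $\tau(H)$ of a hypergraph $H$ is the minimum size of a set of vertices meeting every edge of $H$. For hypergraphs $H_1,H_2$ the wreath product $H_1\rtimes H_2$ has vertex set $\{(v_1,v_2): v_1\in V(H_1), v_2\in V(H_2)\}$ and edge set $\big\{\{(v,u): v\in e,\ u\in f_v\} : e\in E(H_1),\ f_v\in E(H_2)\text{ for each } v\in e\big\}$. -}

module Defs where

open import Data.Nat using (ℕ; _*_; _≤_)
open import Data.Fin using (Fin; combine)
open import Data.Fin.Subset using (Subset; _∈_; ∣_∣)
open import Data.Product using (Σ; ∃; _×_)
open import Function.Bundles using (_⇔_)
open import Relation.Binary.PropositionalEquality using (_≡_)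

record Hypergraph (n : ℕ) : Set₁ where
  field
    Edge : Subset n → Set

open Hypergraph public

IsCover : ∀ {n} → Hypergraph n → Subset n → Set
IsCover H T = ∀ e → Edge H e → ∃ λ v → v ∈ e × v ∈ T

IsCoverNumber : ∀ {n} → Hypergraph n → ℕ → Set
IsCoverNumber H k =
  (∃ λ T → IsCover H T × ∣ T ∣ ≡ k) × (∀ T → IsCover H T → k ≤ ∣ T ∣)

-- Wreath product H₁ ⋊ H₂ on vertex set Fin n₁ × Fin n₂ ≅ Fin (n₁ * n₂)
-- (pair (v , u) encoded as combine v u).
_⋊_ : ∀ {n₁ n₂} → Hypergraph n₁ → Hypergraph n₂ → Hypergraph (n₁ * n₂)
Edge (_⋊_ {n₁} {n₂} H₁ H₂) S =
  Σ (Subset n₁) λ e → Edge H₁ e ×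
  Σ (Fin n₁ → Subset n₂) λ f → (∀ v → v ∈ e → Edge H₂ (f v)) ×
    (∀ v u → (combine v u ∈ S) ⇔ (v ∈ e × u ∈ f v))

{-# OPTIONS --safe #-}
-- The product T₁ × T₂ of minimum covers meets every edge of H₁ ⋊ H₂, so τ ≤ τ₁ τ₂.
-- Conversely, cut a cover T of H₁ ⋊ H₂ into rows T_v = {u : (v , u) ∈ T}.  The rows that
-- cover H₂ index a cover of H₁: if an edge e of H₁ avoided all of them, choosing for each
-- v ∈ e an edge f v of H₂ missed by T_v would give an edge of H₁ ⋊ H₂ missed by T.  So at
-- least τ₁ rows have size ≥ τ₂, and ∣ T ∣ ≥ τ₁ τ₂.
module Submission where

open import Defs
open import Data.Nat using (ℕ; _*_)

open import Data.Bool using (if_then_else_)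
open import Data.Fin using (Fin; zero; suc; combine)
open import Data.Fin.Properties using (any?; combine-surjective)
open import Data.Fin.Subset using (Subset; _∈_; ∣_∣; inside; outside; ⊥)
open import Data.Fin.Subset.Properties using (_∈?_; ∉⊥; ∣⊥∣≡0)
open import Data.Nat using (zero; suc; _+_; _≤_; _≤?_; z≤n)
open import Data.Nat.Properties using (+-mono-≤; m≤n⇒m≤o+n; ≤-trans; *-monoˡ-≤; module ≤-Reasoning)
open import Data.Product using (∃; _×_; _,_; proj₁; proj₂; uncurry)
open import Data.Vec using (Vec; []; _∷_; _++_; lookup; concat; map; tabulate; group)
open import Data.Vec.Properties using (lookup-concat; []=⇒lookup; lookup⇒[]=; lookup-map; lookup∘tabulate)
open import Function using (const; _∘_)
open import Function.Bundles using (Equivalence; mk⇔)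
open import Relation.Nullary using (¬_; Dec; yes; no; does; contradiction)
open import Relation.Nullary.Decidable using (_×-dec_; decidable-stable; dec-true)
open import Relation.Nullary.Negation using (¬¬-map)
open import Relation.Binary.PropositionalEquality using (_≡_; refl; sym; trans; cong; cong₂; subst)

private
  variable
    m n n₁ n₂ k : ℕ

∣++∣ : (p : Subset m) (q : Subset n) → ∣ p ++ q ∣ ≡ ∣ p ∣ + ∣ q ∣
∣++∣ []            q = refl
∣++∣ (inside  ∷ p) q = cong suc (∣++∣ p q)
∣++∣ (outside ∷ p) q = ∣++∣ p q

∈-concat⁺ : ∀ (R : Vec (Subset n) m) {v u} → u ∈ lookup R v → combine v u ∈ concat R
∈-concat⁺ R {v} {u} u∈Rv = lookup⇒[]= _ _ (trans (lookup-concat R v u) ([]=⇒lookup u∈Rv))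

∈-concat⁻ : ∀ (R : Vec (Subset n) m) {v u} → combine v u ∈ concat R → u ∈ lookup R v
∈-concat⁻ R {v} {u} vu∈R = lookup⇒[]= _ _ (trans (sym (lookup-concat R v u)) ([]=⇒lookup vu∈R))

∈-if⁺ : ∀ {b} {p : Subset n} {u} → b ≡ inside → u ∈ p → u ∈ (if b then p else ⊥)
∈-if⁺ refl u∈p = u∈p

∈-if⁻ : ∀ b {p : Subset n} {u} → u ∈ (if b then p else ⊥) → b ≡ inside × u ∈ p
∈-if⁻ inside  u∈p = refl , u∈p
∈-if⁻ outside u∈⊥ = contradiction u∈⊥ ∉⊥

rows : Subset m → (Fin m → Subset n) → Vec (Subset n) m
rows A F = tabulate λ v → if lookup A v then F v else ⊥

_⋉_ : Subset m → (Fin m → Subset n) → Subset (m * n)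
A ⋉ F = concat (rows A F)

∈-⋉⁺ : ∀ {A : Subset m} {F : Fin m → Subset n} {v u} → v ∈ A → u ∈ F v → combine v u ∈ A ⋉ F
∈-⋉⁺ {A = A} {F} {v} {u} v∈A u∈Fv =
  ∈-concat⁺ (rows A F) (subst (u ∈_) (sym (lookup∘tabulate _ v)) (∈-if⁺ ([]=⇒lookup v∈A) u∈Fv))

∈-⋉⁻ : ∀ {A : Subset m} {F : Fin m → Subset n} {v u} → combine v u ∈ A ⋉ F → v ∈ A × u ∈ F v
∈-⋉⁻ {A = A} {F} {v} {u} vu∈A⋉F
  with ∈-if⁻ (lookup A v) (subst (u ∈_) (lookup∘tabulate _ v) (∈-concat⁻ (rows A F) vu∈A⋉F))
... | Av≡inside , u∈Fv = lookup⇒[]= v A Av≡inside , u∈Fv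

∣⋉const∣ : ∀ (A : Subset m) (p : Subset n) → ∣ A ⋉ const p ∣ ≡ ∣ A ∣ * ∣ p ∣
∣⋉const∣         []            p = refl
∣⋉const∣         (inside  ∷ A) p = trans (∣++∣ p _) (cong (∣ p ∣ +_) (∣⋉const∣ A p))
∣⋉const∣ {n = n} (outside ∷ A) p = trans (∣++∣ (⊥ {n}) (A ⋉ const p)) (cong₂ _+_ (∣⊥∣≡0 n) (∣⋉const∣ A p))

heavy : ℕ → Vec (Subset n) m → Subset m
heavy k = map λ r → does (k ≤? ∣ r ∣)

heavy⁺ : ∀ (R : Vec (Subset n) m) {v} → k ≤ ∣ lookup R v ∣ → v ∈ heavy k R
heavy⁺ {k = k} R {v} k≤∣Rv∣ =
  lookup⇒[]= v _ (trans (lookup-map v _ R) (dec-true (k ≤? ∣ lookup R v ∣) k≤∣Rv∣))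

∣heavy∣*k≤∣concat∣ : ∀ (R : Vec (Subset n) m) → ∣ heavy k R ∣ * k ≤ ∣ concat R ∣
∣heavy∣*k≤∣concat∣         []      = z≤n
∣heavy∣*k≤∣concat∣ {k = k} (r ∷ R) =
  begin
    ∣ heavy k (r ∷ R) ∣ * k  ≤⟨ add-row (heavy k R) (k ≤? ∣ r ∣) (∣heavy∣*k≤∣concat∣ R) ⟩
    ∣ r ∣ + ∣ concat R ∣      ≡⟨ ∣++∣ r (concat R) ⟨
    ∣ concat (r ∷ R) ∣        ∎
  where
  open ≤-Reasoning
  add-row : ∀ {m c} (h : Subset m) (k≤?∣r∣ : Dec (k ≤ ∣ r ∣)) →
            ∣ h ∣ * k ≤ c → ∣ does k≤?∣r∣ ∷ h ∣ * k ≤ ∣ r ∣ + c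
  add-row h (yes k≤∣r∣) = +-mono-≤ k≤∣r∣
  add-row h (no _)      = m≤n⇒m≤o+n ∣ r ∣

Meets : Subset n → Subset n → Set
Meets e T = ∃ λ v → v ∈ e × v ∈ T

meets? : (e T : Subset n) → Dec (Meets e T)
meets? e T = any? λ v → v ∈? e ×-dec v ∈? T

IsCoverLowerBound : Hypergraph n → ℕ → Set
IsCoverLowerBound H k = ∀ T → IsCover H T → k ≤ ∣ T ∣

¬cover⇒¬¬missedEdge : ∀ (H : Hypergraph n) {T} → ¬ IsCover H T → ¬ ¬ ∃ λ f → Edge H f × ¬ Meets f T
¬cover⇒¬¬missedEdge H {T} ¬cover ¬missed =
  ¬cover λ e e∈H → decidable-stable (meets? e T) λ ¬meets → ¬missed (e , e∈H , ¬meets)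

¬¬-Π-Fin : ∀ {P : Fin n → Set} → (∀ v → ¬ ¬ P v) → ¬ ¬ (∀ v → P v)
¬¬-Π-Fin {zero}  _   ¬∀P = ¬∀P λ ()
¬¬-Π-Fin {suc n} ¬¬P ¬∀P =
  ¬¬P zero λ P0 → ¬¬-Π-Fin (¬¬P ∘ suc) λ ∀P → ¬∀P λ { zero → P0 ; (suc v) → ∀P v }

⋉-const-cover : ∀ (H₁ : Hypergraph n₁) (H₂ : Hypergraph n₂) {T₁ T₂} →
                IsCover H₁ T₁ → IsCover H₂ T₂ → IsCover (H₁ ⋊ H₂) (T₁ ⋉ const T₂)
⋉-const-cover H₁ H₂ T₁-cover T₂-cover S (e , e∈H₁ , f , f∈H₂ , S⇔)
  with v , v∈e , v∈T₁ ← T₁-cover e e∈H₁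
  with u , u∈fv , u∈T₂ ← T₂-cover (f v) (f∈H₂ v v∈e)
  = combine v u , Equivalence.from (S⇔ v u) (v∈e , u∈fv) , ∈-⋉⁺ v∈T₁ u∈T₂

⋉-edge : ∀ (H₁ : Hypergraph n₁) (H₂ : Hypergraph n₂) {e F} →
         Edge H₁ e → (∀ v → v ∈ e → Edge H₂ (F v)) → Edge (H₁ ⋊ H₂) (e ⋉ F)
⋉-edge H₁ H₂ e∈H₁ F∈H₂ = _ , e∈H₁ , _ , F∈H₂ , λ v u → mk⇔ ∈-⋉⁻ (uncurry ∈-⋉⁺)

someRow-covers : ∀ (H₁ : Hypergraph n₁) (H₂ : Hypergraph n₂) (R : Vec (Subset n₂) n₁) →
                 IsCover (H₁ ⋊ H₂) (concat R) →
                 ∀ {e} → Edge H₁ e → ¬ ¬ ∃ λ v → v ∈ e × IsCover H₂ (lookup R v)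
someRow-covers {n₁} {n₂} H₁ H₂ R cover {e} e∈H₁ ¬rowCovers = ¬¬-Π-Fin missedEdge λ F →
  avoided F (cover (e ⋉ (proj₁ ∘ F)) (⋉-edge H₁ H₂ e∈H₁ λ v v∈e → proj₁ (proj₂ (F v) v∈e)))
  where
  MissedEdge : Fin n₁ → Set
  MissedEdge v = ∃ λ f → v ∈ e → Edge H₂ f × ¬ Meets f (lookup R v)

  missedEdge : ∀ v → ¬ ¬ MissedEdge v
  missedEdge v with v ∈? e
  ... | yes v∈e = ¬¬-map (λ (f , f∈H₂ , ¬meets) → f , λ _ → f∈H₂ , ¬meets)
                         (¬cover⇒¬¬missedEdge H₂ λ Rv-cover → ¬rowCovers (v , v∈e , Rv-cover))
  ... | no  v∉e = λ ¬missed → ¬missed (⊥ , λ v∈e → contradiction v∈e v∉e)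

  avoided : (F : ∀ v → MissedEdge v) → ¬ Meets (e ⋉ (proj₁ ∘ F)) (concat R)
  avoided F (w , w∈S , w∈R) with v , u , refl ← combine-surjective {n₁} {n₂} w with ∈-⋉⁻ w∈S
  ... | v∈e , u∈Fv = proj₂ (proj₂ (F v) v∈e) (u , u∈Fv , ∈-concat⁻ R w∈R)

-- The covering rows need not form a decidable set, but the heavy rows (size ≥ k) do and
-- contain them; this is what discharges the double negation of someRow-covers.
heavyRows-cover : ∀ (H₁ : Hypergraph n₁) (H₂ : Hypergraph n₂) (R : Vec (Subset n₂) n₁) →
                  IsCoverLowerBound H₂ k → IsCover (H₁ ⋊ H₂) (concat R) → IsCover H₁ (heavy k R)
heavyRows-cover {k = k} H₁ H₂ R k-bound cover e e∈H₁ =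
  decidable-stable (meets? e (heavy k R))
    (¬¬-map (λ (v , v∈e , Rv-cover) → v , v∈e , heavy⁺ R (k-bound _ Rv-cover))
            (someRow-covers H₁ H₂ R cover e∈H₁))

⋊-coverLowerBound : ∀ {k₁ k₂} (H₁ : Hypergraph n₁) (H₂ : Hypergraph n₂) →
                    IsCoverLowerBound H₁ k₁ → IsCoverLowerBound H₂ k₂ →
                    IsCoverLowerBound (H₁ ⋊ H₂) (k₁ * k₂)
⋊-coverLowerBound {n₁} {n₂} {k₂ = k₂} H₁ H₂ k₁-bound k₂-bound T cover
  with R , refl ← group n₁ n₂ T
  = ≤-trans (*-monoˡ-≤ k₂ (k₁-bound _ (heavyRows-cover H₁ H₂ R k₂-bound cover)))
            (∣heavy∣*k≤∣concat∣ R)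

lemma2p4 : ∀ {n₁ n₂} (H₁ : Hypergraph n₁) (H₂ : Hypergraph n₂) (k₁ k₂ : ℕ) →
             IsCoverNumber H₁ k₁ → IsCoverNumber H₂ k₂ →
             IsCoverNumber (H₁ ⋊ H₂) (k₁ * k₂)
lemma2p4 H₁ H₂ k₁ k₂ ((T₁ , T₁-cover , ∣T₁∣≡k₁) , k₁-bound) ((T₂ , T₂-cover , ∣T₂∣≡k₂) , k₂-bound) =
  (T₁ ⋉ const T₂ , ⋉-const-cover H₁ H₂ T₁-cover T₂-cover ,
   trans (∣⋉const∣ T₁ T₂) (cong₂ _*_ ∣T₁∣≡k₁ ∣T₂∣≡k₂)) ,
  ⋊-coverLowerBound H₁ H₂ k₁-bound k₂-bound
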